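{- For $n \geq 2$, $$\sum_{v \in A_n} x^{\ell_{T(A_n)}(v)} = \sum_{k=0}^{n} a(n,k)\, x^k = \prod_{t=2}^{n-1} (1 + t x).$$
   Context: $A_n$ is the alternating group on $\{1,\dots,n\}$. Set $T(A_n) = \{(1\,2)(i\,j) \mid 1 \le i<j \le n\}$, a generating set of $A_n$. The length $\ell_{T(A_n)}(v)$ is the minimal $k\ge0$ such that $v$ is a product of $k$ elements of $T(A_n)$. $a(n,k)$ is the number of $v \in A_n$ with $\ell_{T(A_n)}(v) = k$. An empty product equals $1$. -}

module Defs where

open import Data.Nat using (ℕ; zero; suc; _+_; _*_; _<_; _%_)
open import Data.Fin using (Fin; _≟_) renaming (_<?_ to _<ᶠ?_; _<_ to _<ᶠ_)
import Data.Fin as F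
open import Data.Vec using (Vec; lookup; tabulate)
open import Data.List using (List; []; _∷_; length; filter; cartesianProduct; allFin; foldr; map; upTo)
open import Data.List.Membership.Propositional using (_∈_)
open import Data.List.Relation.Unary.Unique.Propositional using (Unique)
open import Data.Product using (Σ; _×_; _,_; ∃)
open import Relation.Nullary using (¬_; yes; no)
open import Relation.Nullary.Decidable using (_×-dec_)
open import Relation.Binary.PropositionalEquality using (_≡_)
open import Function using (_∘_; id)
open import Function.Bundles using (_⇔_)

-- A permutation of {1,…,n} is represented (0-indexed) by its vector of images.
Word : ℕ → Set
Word n = Vec (Fin n) n

IsPerm : ∀ {n} → Word n → Set
IsPerm {n} v = ∀ (i j : Fin n) → lookup v i ≡ lookup v j → i ≡ j

inversions : ∀ {n} → Word n → ℕ
inversions {n} v =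
  length (filter (λ p → (Data.Product.proj₁ p <ᶠ? Data.Product.proj₂ p)
                        ×-dec (lookup v (Data.Product.proj₂ p) <ᶠ? lookup v (Data.Product.proj₁ p)))
                 (cartesianProduct (allFin n) (allFin n)))

InAlt : ∀ {n} → Word n → Set
InAlt v = IsPerm v × (inversions v % 2 ≡ 0)

swap : ∀ {n} → Fin n → Fin n → Fin n → Fin n
swap a b x with x ≟ a
... | yes _ = b
... | no _ with x ≟ b
...   | yes _ = a
...   | no _ = x

-- Points 1 and 2 of {1,…,n} are F.zero and F.suc F.zero (n = m + 2).
-- The generator (1 2)(i j), composed right-to-left as functions.
gen : ∀ {m} → Fin (suc (suc m)) → Fin (suc (suc m)) → Fin (suc (suc m)) → Fin (suc (suc m))
gen i j = swap F.zero (F.suc F.zero) ∘ swap i j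

-- An element of T(A_n): a pair (i , j) with i < j.
TGen : ℕ → Set
TGen m = Σ (Fin (suc (suc m)) × Fin (suc (suc m))) (λ p → Data.Product.proj₁ p <ᶠ Data.Product.proj₂ p)

evalGen : ∀ {m} → TGen m → Fin (suc (suc m)) → Fin (suc (suc m))
evalGen ((i , j) , _) = gen i j

prodT : ∀ {m} → List (TGen m) → Fin (suc (suc m)) → Fin (suc (suc m))
prodT = foldr (λ t f → evalGen t ∘ f) id

IsProdOf : ∀ {m} → Word (suc (suc m)) → ℕ → Set
IsProdOf {m} v k = ∃ λ (ts : List (TGen m)) → length ts ≡ k × (∀ x → prodT ts x ≡ lookup v x)

HasLength : ∀ {m} → Word (suc (suc m)) → ℕ → Set
HasLength v k = IsProdOf v k × (∀ j → j < k → ¬ IsProdOf v j)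

-- "a(n,k) = c" : exactly c elements v ∈ A_n have ℓ(v) = k (n = m + 2)
CountIs : (m k c : ℕ) → Set
CountIs m k c = ∃ λ (L : List (Word (suc (suc m)))) →
  Unique L × (∀ v → (v ∈ L) ⇔ (InAlt v × HasLength v k)) × length L ≡ c

-- polynomials with ℕ coefficients as coefficient functions
Poly : Set
Poly = ℕ → ℕ

one : Poly
one zero = 1
one (suc k) = 0

-- multiply p by (1 + t x)
mulLin : ℕ → Poly → Poly
mulLin t p zero = p zero
mulLin t p (suc k) = p (suc k) + t * p k

prodLin : List ℕ → Poly
prodLin [] = one
prodLin (t ∷ ts) = mulLin t (prodLin ts)

-- ∏_{t=2}^{n-1} (1 + t x) for n = m + 2, i.e. t ranges over 2 … m+1
rhsPoly : ℕ → Poly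
rhsPoly m = prodLin (map (2 +_) (upTo m))

module Submission where

-- A permutation f of m + 3 points is determined by p = f new, for a fixed point new other
-- than 1 and 2, together with the permutation reduce f of the other m + 2 points left after
-- moving p back to new by mover p, which is 1 if p = new and one generator otherwise.  The
-- weights (0 or 1) of the movers met while reducing f down to two points add up to depth f.
--  * Parity: each transposition reverses the parity of the inversion count, so generators
--    preserve it and (1 2) reverses it.
--  * Upper bound: unwinding the reduction writes f as depth f generators followed by 1 or
--    (1 2); for even f the parity forces 1, so ℓ_T(f) ≤ depth f.
--  * Lower bound: composing with a generator changes reduce f by the identity or by a
--    generator, and raises the depth by at most one; so depth f ≤ ℓ_T(f).
--  * Counting: f ↦ (f new, reduce f) is a bijection onto pairs, preserving evenness, with
--    depth f = weight (f new) + depth (reduce f), and only f new = new has weight 0.  Hence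
--    a(m + 3, k) = a(m + 2, k) + (m + 2) · a(m + 2, k - 1), the recursion of the product.

open import Defs
open import Data.Nat as ℕ using (ℕ; parity; zero; suc; _+_; _*_; _≤_; _%_; z≤n; s≤s)
import Data.Nat.Properties as ℕP
open import Data.Nat.Tactic.RingSolver using (solve-∀)
open import Data.Fin as Fin using (Fin; _≟_; toℕ; inject₁)
import Data.Fin.Properties as FinP
open import Data.Product using (_×_; _,_; proj₁; proj₂; ∃)
open import Data.Sum using (_⊎_; inj₁; inj₂)
open import Data.Empty using (⊥-elim)
open import Function using (_∘_; id; flip)
open import Function.Definitions using (Injective)
open import Function.Bundles using (_⇔_; mk⇔)
open import Relation.Nullary using (¬_; yes; no; Dec)
open import Relation.Nullary.Decidable using (_×-dec_)
open import Relation.Unary using (Pred; Decidable)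
open import Relation.Binary.PropositionalEquality
open import Level using (0ℓ)
open import Relation.Binary using (Tri; tri<; tri≈; tri>)
open import Data.Parity.Base using (Parity; 0ℙ; 1ℙ; _⁻¹)
open import Data.Parity.Properties using (⁻¹-involutive; ⁻¹-selfInverse; suc-homo-⁻¹)
open import Data.List using (List; []; _∷_; length; filter; cartesianProduct; allFin; map; _++_; upTo)
import Data.List as List
open import Data.List.Relation.Unary.All using (All; []; _∷_)
import Data.List.Relation.Unary.All as All
open import Data.List.Relation.Unary.Any using (here; there)
open import Data.List.Relation.Unary.Unique.Propositional using (Unique; []; _∷_)
open import Data.List.Membership.Propositional using (_∈_)
open import Data.List.Membership.Propositional.Properties
  using (∈-cartesianProduct⁺; ∈-allFin; ∈-++⁻; ∈-++⁺ˡ; ∈-++⁺ʳ; ∈-map⁻; ∈-map⁺)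
open import Data.List.Relation.Unary.Unique.Propositional.Properties using (cartesianProduct⁺; allFin⁺; ++⁺; map⁺)
open import Data.List.Properties using (filter-≐; filter-none; length-map; length-++; upTo-∷ʳ; map-++)
open import Data.Vec using (Vec; lookup)
import Data.Vec as Vec
open import Data.Vec.Properties using (lookup∘tabulate; tabulate∘lookup; tabulate-cong)

private variable n : ℕ

Fun : ℕ → Set
Fun n = Fin n → Fin n

Inj : ∀ {n k} → (Fin n → Fin k) → Set
Inj = Injective _≡_ _≡_

Onto : Fun n → Set
Onto {n} f = ∀ y → ∃ λ (x : Fin n) → f x ≡ y

parity-suc : ∀ k → parity (suc k) ≡ parity k ⁻¹
parity-suc k = sym (⁻¹-selfInverse (suc-homo-⁻¹ k))

%2≡0⇒parity : ∀ k → k % 2 ≡ 0 → parity k ≡ 0ℙ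
%2≡0⇒parity zero _ = refl
%2≡0⇒parity (suc zero) ()
%2≡0⇒parity (suc (suc k)) = %2≡0⇒parity k

parity⇒%2≡0 : ∀ k → parity k ≡ 0ℙ → k % 2 ≡ 0
parity⇒%2≡0 zero _ = refl
parity⇒%2≡0 (suc zero) ()
parity⇒%2≡0 (suc (suc k)) = parity⇒%2≡0 k

swap-left : (a b : Fin n) → swap a b a ≡ b
swap-left a b with a ≟ a
... | yes _ = refl
... | no a≢a = ⊥-elim (a≢a refl)

swap-right : (a b : Fin n) → swap a b b ≡ a
swap-right a b with b ≟ a
... | yes b≡a = b≡a
... | no _ with b ≟ b
...   | yes _ = refl
...   | no b≢b = ⊥-elim (b≢b refl)

swap-other : (a b x : Fin n) → x ≢ a → x ≢ b → swap a b x ≡ x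
swap-other a b x x≢a x≢b with x ≟ a
... | yes x≡a = ⊥-elim (x≢a x≡a)
... | no _ with x ≟ b
...   | yes x≡b = ⊥-elim (x≢b x≡b)
...   | no _ = refl

swap-natural : ∀ {k} (φ : Fin n → Fin k) → Inj φ →
               ∀ a b x → φ (swap a b x) ≡ swap (φ a) (φ b) (φ x)
swap-natural φ φ-inj a b x = by-cases (x ≟ a) (x ≟ b)
  where
  by-cases : Dec (x ≡ a) → Dec (x ≡ b) → φ (swap a b x) ≡ swap (φ a) (φ b) (φ x)
  by-cases (yes refl) _ = trans (cong φ (swap-left x b)) (sym (swap-left (φ x) (φ b)))
  by-cases (no _) (yes refl) = trans (cong φ (swap-right a x)) (sym (swap-right (φ a) (φ x)))
  by-cases (no x≢a) (no x≢b) =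
    trans (cong φ (swap-other a b x x≢a x≢b))
          (sym (swap-other (φ a) (φ b) (φ x) (x≢a ∘ φ-inj) (x≢b ∘ φ-inj)))

swap-involutive : (a b x : Fin n) → swap a b (swap a b x) ≡ x
swap-involutive a b x = by-cases (x ≟ a) (x ≟ b)
  where
  by-cases : Dec (x ≡ a) → Dec (x ≡ b) → swap a b (swap a b x) ≡ x
  by-cases (yes refl) _ = trans (cong (swap x b) (swap-left x b)) (swap-right x b)
  by-cases (no _) (yes refl) = trans (cong (swap a x) (swap-right a x)) (swap-left a x)
  by-cases (no x≢a) (no x≢b) =
    trans (cong (swap a b) (swap-other a b x x≢a x≢b)) (swap-other a b x x≢a x≢b)

swap-comm : (a b x : Fin n) → swap a b x ≡ swap b a x
swap-comm a b x = by-cases (x ≟ a) (x ≟ b)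
  where
  by-cases : Dec (x ≡ a) → Dec (x ≡ b) → swap a b x ≡ swap b a x
  by-cases (yes refl) _ = trans (swap-left x b) (sym (swap-right b x))
  by-cases (no _) (yes refl) = trans (swap-right a x) (sym (swap-left x a))
  by-cases (no x≢a) (no x≢b) = trans (swap-other a b x x≢a x≢b) (sym (swap-other b a x x≢b x≢a))

swap-injective : (a b : Fin n) → Inj (swap a b)
swap-injective a b {x} {y} eq =
  trans (sym (swap-involutive a b x)) (trans (cong (swap a b) eq) (swap-involutive a b y))

swap-conjugate : (a b x y z : Fin n) →
                 swap a b (swap x y (swap a b z)) ≡ swap (swap a b x) (swap a b y) z
swap-conjugate a b x y z =
  trans (swap-natural (swap a b) (swap-injective a b) x y (swap a b z))
        (cong (swap (swap a b x) (swap a b y)) (swap-involutive a b z))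

swap-determined : (i j p w : Fin n) → swap i j p ≡ w → p ≢ w → ∀ z → swap i j z ≡ swap p w z
swap-determined i j p w ijp≡w p≢w z = by-cases (p ≟ i) (p ≟ j)
  where
  by-cases : Dec (p ≡ i) → Dec (p ≡ j) → swap i j z ≡ swap p w z
  by-cases (yes refl) _ with trans (sym (swap-left p j)) ijp≡w
  ... | refl = refl
  by-cases (no _) (yes refl) with trans (sym (swap-right i p)) ijp≡w
  ... | refl = swap-comm i p z
  by-cases (no p≢i) (no p≢j) = ⊥-elim (p≢w (trans (sym (swap-other i j p p≢i p≢j)) ijp≡w))

swap-conjugate-fixing : (i j p w z : Fin n) → w ≢ i → w ≢ j →
                        swap i j (swap p w z) ≡ swap (swap i j p) w (swap i j z)
swap-conjugate-fixing i j p w z w≢i w≢j =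
  trans (swap-natural (swap i j) (swap-injective i j) p w z)
        (cong (λ u → swap (swap i j p) u (swap i j z)) (swap-other i j w w≢i w≢j))

module _ {A : Set} {P Q : Pred A 0ℓ} (P? : Decidable P) (Q? : Decidable Q) (x₀ : A)
         (P⇒Q : ∀ z → z ≢ x₀ → P z → Q z) (Q⇒P : ∀ z → z ≢ x₀ → Q z → P z) where

  #P #Q : List A → ℕ
  #P L = length (filter P? L)
  #Q L = length (filter Q? L)

  count-agree : ∀ {L} → All (x₀ ≢_) L → #P L ≡ #Q L
  count-agree [] = refl
  count-agree {z ∷ L} (x₀≢z ∷ rest) with P? z | Q? z
  ... | yes _ | yes _ = cong suc (count-agree rest)
  ... | yes pz | no ¬qz = ⊥-elim (¬qz (P⇒Q z (x₀≢z ∘ sym) pz))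
  ... | no ¬pz | yes qz = ⊥-elim (¬pz (Q⇒P z (x₀≢z ∘ sym) qz))
  ... | no _ | no _ = count-agree rest

  count-flip : (P x₀ → ¬ Q x₀) → (¬ P x₀ → Q x₀) → ∀ {L} → Unique L → x₀ ∈ L →
               parity (#P L) ≡ parity (#Q L) ⁻¹
  count-flip P⇒¬Q ¬P⇒Q {x₀ ∷ L} (x₀∉L ∷ _) (here refl) with P? x₀ | Q? x₀
  ... | yes px | yes qx = ⊥-elim (P⇒¬Q px qx)
  ... | yes _ | no _ = trans (parity-suc (#P L)) (cong (λ k → parity k ⁻¹) (count-agree x₀∉L))
  ... | no _ | yes _ = trans (cong parity (count-agree x₀∉L))
                             (sym (trans (cong _⁻¹ (parity-suc (#Q L))) (⁻¹-involutive _)))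
  ... | no ¬px | no ¬qx = ⊥-elim (¬qx (¬P⇒Q ¬px))
  count-flip P⇒¬Q ¬P⇒Q {z ∷ L} (z∉L ∷ unique) (there x₀∈L) with P? z | Q? z
  ... | yes _ | yes _ =
    trans (parity-suc (#P L)) (trans (cong _⁻¹ IH) (cong _⁻¹ (sym (parity-suc (#Q L)))))
    where
    IH : parity (#P L) ≡ parity (#Q L) ⁻¹
    IH = count-flip P⇒¬Q ¬P⇒Q unique x₀∈L
  ... | yes pz | no ¬qz = ⊥-elim (¬qz (P⇒Q z z≢x₀ pz))
    where
    z≢x₀ : z ≢ x₀
    z≢x₀ = All.lookup z∉L x₀∈L
  ... | no ¬pz | yes qz = ⊥-elim (¬pz (Q⇒P z z≢x₀ qz))
    where
    z≢x₀ : z ≢ x₀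
    z≢x₀ = All.lookup z∉L x₀∈L
  ... | no _ | no _ = count-flip P⇒¬Q ¬P⇒Q unique x₀∈L

pairs : ∀ n → List (Fin n × Fin n)
pairs n = cartesianProduct (allFin n) (allFin n)

IsInversion : Fun n → Pred (Fin n × Fin n) 0ℓ
IsInversion f (i , j) = i Fin.< j × f j Fin.< f i

isInversion? : (f : Fun n) → Decidable (IsInversion f)
isInversion? f (i , j) = (i Fin.<? j) ×-dec (f j Fin.<? f i)

invCount : Fun n → ℕ
invCount {n} f = length (filter (isInversion? f) (pairs n))

pairs-unique : ∀ n → Unique (pairs n)
pairs-unique n = cartesianProduct⁺ (allFin⁺ n) (allFin⁺ n)

∈-pairs : (i j : Fin n) → (i , j) ∈ pairs n
∈-pairs i j = ∈-cartesianProduct⁺ (∈-allFin i) (∈-allFin j)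

invCount-cong : {f g : Fun n} → (∀ x → f x ≡ g x) → invCount f ≡ invCount g
invCount-cong {n} {f} {g} f≗g = cong length (filter-≐ (isInversion? f) (isInversion? g)
  ((λ {(i , j)} (i<j , inv) → i<j , subst₂ Fin._<_ (f≗g j) (f≗g i) inv) ,
   (λ {(i , j)} (i<j , inv) → i<j , subst₂ Fin._<_ (sym (f≗g j)) (sym (f≗g i)) inv))
  (pairs n))

invCount-id : ∀ n → invCount {n} id ≡ 0
invCount-id n = cong length (filter-none (isInversion? id)
  (All.universal (λ (i , j) (i<j , j<i) → ℕP.<-asym i<j j<i) (pairs n)))

module Adjacent {n : ℕ} (b : Fin n) where

  a a⁺ : Fin (suc n)
  a = inject₁ b
  a⁺ = Fin.suc b

  s : Fun (suc n)
  s = swap a a⁺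

  toℕ-a : toℕ a ≡ toℕ b
  toℕ-a = FinP.toℕ-inject₁ b

  a<a⁺ : a Fin.< a⁺
  a<a⁺ = subst (ℕ._< suc (toℕ b)) (sym toℕ-a) (ℕP.n<1+n (toℕ b))

  s-monotone : ∀ {x y} → x Fin.< y → ¬ (x ≡ a × y ≡ a⁺) → s x Fin.< s y
  s-monotone {x} {y} x<y not-a-a⁺ = by-cases (x ≟ a) (x ≟ a⁺) (y ≟ a) (y ≟ a⁺)
    where
    -- a point strictly between a and a⁺ in value does not exist
    above-a : ∀ {z} → a Fin.< z → z ≢ a⁺ → a⁺ Fin.< z
    above-a {z} a<z z≢a⁺ =
      ℕP.≤∧≢⇒< (subst (ℕ._< toℕ z) toℕ-a a<z) (z≢a⁺ ∘ FinP.toℕ-injective ∘ sym)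
    below-a⁺ : ∀ {z} → z Fin.< a⁺ → z ≢ a → z Fin.< a
    below-a⁺ {z} (s≤s z≤b) z≢a =
      subst (toℕ z ℕ.<_) (sym toℕ-a)
            (ℕP.≤∧≢⇒< z≤b (z≢a ∘ FinP.toℕ-injective ∘ flip trans (sym toℕ-a)))
    by-cases : Dec (x ≡ a) → Dec (x ≡ a⁺) → Dec (y ≡ a) → Dec (y ≡ a⁺) → s x Fin.< s y
    by-cases (yes refl) _ (yes refl) _ = ⊥-elim (FinP.<-irrefl refl x<y)
    by-cases (yes refl) _ (no _) (yes refl) = ⊥-elim (not-a-a⁺ (refl , refl))
    by-cases (yes refl) _ (no y≢a) (no y≢a⁺) rewrite swap-left a a⁺ | swap-other a a⁺ y y≢a y≢a⁺ =
      above-a x<y y≢a⁺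
    by-cases (no _) (yes refl) (yes refl) _ = ⊥-elim (ℕP.<-asym x<y a<a⁺)
    by-cases (no _) (yes refl) (no _) (yes refl) = ⊥-elim (FinP.<-irrefl refl x<y)
    by-cases (no _) (yes refl) (no y≢a) (no y≢a⁺) rewrite swap-right a a⁺ | swap-other a a⁺ y y≢a y≢a⁺ =
      ℕP.<-trans a<a⁺ x<y
    by-cases (no x≢a) (no x≢a⁺) (yes refl) _ rewrite swap-left a a⁺ | swap-other a a⁺ x x≢a x≢a⁺ =
      ℕP.<-trans x<y a<a⁺
    by-cases (no x≢a) (no x≢a⁺) (no _) (yes refl) rewrite swap-right a a⁺ | swap-other a a⁺ x x≢a x≢a⁺ =
      below-a⁺ x<y x≢a
    by-cases (no x≢a) (no x≢a⁺) (no y≢a) (no y≢a⁺)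
      rewrite swap-other a a⁺ x x≢a x≢a⁺ | swap-other a a⁺ y y≢a y≢a⁺ = x<y

  Exchanged : Fin (suc n) → Fin (suc n) → Set
  Exchanged x y = (x ≡ a × y ≡ a⁺) ⊎ (x ≡ a⁺ × y ≡ a)

  exchanged-swap : ∀ {x y} → Exchanged x y → s x ≡ y × s y ≡ x
  exchanged-swap (inj₁ (refl , refl)) = swap-left a a⁺ , swap-right a a⁺
  exchanged-swap (inj₂ (refl , refl)) = swap-right a a⁺ , swap-left a a⁺

  unswap : ∀ {x y z} → s x ≡ y → s y ≡ z → x ≡ z
  unswap {x} sx≡y sy≡z = trans (sym (swap-involutive a a⁺ x)) (trans (cong s sx≡y) sy≡z)

  -- Composing an injection f with s changes the inversion status of exactly one pair:
  -- the pair of positions (i₀ , j₀) of the values a and a⁺.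
  flip-at : (f : Fun (suc n)) → Inj f → ∀ i₀ j₀ → i₀ Fin.< j₀ → Exchanged (f i₀) (f j₀) →
            (∀ {i j} → i Fin.< j → Exchanged (f i) (f j) → (i , j) ≡ (i₀ , j₀)) →
            parity (invCount (s ∘ f)) ≡ parity (invCount f) ⁻¹
  flip-at f f-inj i₀ j₀ i₀<j₀ ex₀ only =
    count-flip (isInversion? (s ∘ f)) (isInversion? f) (i₀ , j₀) s∘f⇒f f⇒s∘f at-x₀ at-x₀′
               (pairs-unique _) (∈-pairs i₀ j₀)
    where
    s∘f⇒f : ∀ z → z ≢ (i₀ , j₀) → IsInversion (s ∘ f) z → IsInversion f z
    s∘f⇒f (i , j) z≢x₀ (i<j , inv) =
      i<j , subst₂ Fin._<_ (swap-involutive a a⁺ (f j)) (swap-involutive a a⁺ (f i))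
                   (s-monotone inv (λ (e₁ , e₂) → z≢x₀ (only i<j (inj₁ (unswap e₂ (swap-right a a⁺) ,
                                                                    unswap e₁ (swap-left a a⁺))))))
    f⇒s∘f : ∀ z → z ≢ (i₀ , j₀) → IsInversion f z → IsInversion (s ∘ f) z
    f⇒s∘f (i , j) z≢x₀ (i<j , inv) =
      i<j , s-monotone inv (λ (e₁ , e₂) → z≢x₀ (only i<j (inj₂ (e₂ , e₁))))
    swapped : s (f j₀) Fin.< s (f i₀) → f i₀ Fin.< f j₀
    swapped = subst₂ Fin._<_ (proj₂ (exchanged-swap ex₀)) (proj₁ (exchanged-swap ex₀))
    at-x₀ : IsInversion (s ∘ f) (i₀ , j₀) → ¬ IsInversion f (i₀ , j₀)
    at-x₀ (_ , inv) (_ , inv′) = ℕP.<-asym (swapped inv) inv′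
    at-x₀′ : ¬ IsInversion (s ∘ f) (i₀ , j₀) → IsInversion f (i₀ , j₀)
    at-x₀′ ¬inv with FinP.<-cmp (f i₀) (f j₀)
    ... | tri< lt _ _ = ⊥-elim (¬inv (i₀<j₀ , subst₂ Fin._<_ (sym (proj₂ (exchanged-swap ex₀)))
                                                          (sym (proj₁ (exchanged-swap ex₀))) lt))
    ... | tri≈ _ eq _ = ⊥-elim (FinP.<-irrefl (f-inj eq) i₀<j₀)
    ... | tri> _ _ gt = i₀<j₀ , gt

  adjacent-flip : (f : Fun (suc n)) → Inj f → Onto f →
                  parity (invCount (s ∘ f)) ≡ parity (invCount f) ⁻¹
  adjacent-flip f f-inj f-onto with f-onto a | f-onto a⁺
  ... | u , fu | w , fw = by-order (FinP.<-cmp u w)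
    where
    positions : ∀ {i j} → Exchanged (f i) (f j) → (i ≡ u × j ≡ w) ⊎ (i ≡ w × j ≡ u)
    positions (inj₁ (e₁ , e₂)) = inj₁ (f-inj (trans e₁ (sym fu)) , f-inj (trans e₂ (sym fw)))
    positions (inj₂ (e₁ , e₂)) = inj₂ (f-inj (trans e₁ (sym fw)) , f-inj (trans e₂ (sym fu)))
    by-order : Tri (u Fin.< w) (u ≡ w) (w Fin.< u) → parity (invCount (s ∘ f)) ≡ parity (invCount f) ⁻¹
    by-order (tri< u<w _ _) = flip-at f f-inj u w u<w (inj₁ (fu , fw)) only
      where
      only : ∀ {i j} → i Fin.< j → Exchanged (f i) (f j) → (i , j) ≡ (u , w)
      only i<j ex with positions ex
      ... | inj₁ (refl , refl) = refl
      ... | inj₂ (refl , refl) = ⊥-elim (ℕP.<-asym i<j u<w)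
    by-order (tri≈ _ refl _) = ⊥-elim (FinP.<-irrefl (trans (sym fu) fw) a<a⁺)
    by-order (tri> _ _ w<u) = flip-at f f-inj w u w<u (inj₂ (fw , fu)) only
      where
      only : ∀ {i j} → i Fin.< j → Exchanged (f i) (f j) → (i , j) ≡ (w , u)
      only i<j ex with positions ex
      ... | inj₁ (refl , refl) = ⊥-elim (ℕP.<-asym i<j w<u)
      ... | inj₂ (refl , refl) = refl

swap∘-inj : (i j : Fin n) {f : Fun n} → Inj f → Inj (swap i j ∘ f)
swap∘-inj i j f-inj = f-inj ∘ swap-injective i j

swap∘-onto : (i j : Fin n) {f : Fun n} → Onto f → Onto (swap i j ∘ f)
swap∘-onto i j f-onto y with f-onto (swap i j y)
... | x , fx = x , trans (cong (swap i j) fx) (swap-involutive i j y)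

-- A transposition (i j) with j = i + k + 1 reverses the inversion parity of a bijection:
-- for k = 0 it is adjacent, otherwise (i j) = (j′ j)(i j′)(j′ j) with j′ = j - 1.
transposition-flip-at : ∀ k {n} (i j : Fin n) → toℕ j ≡ toℕ i + suc k → ∀ f → Inj f → Onto f →
                        parity (invCount (swap i j ∘ f)) ≡ parity (invCount f) ⁻¹
transposition-flip-at k i Fin.zero j≡i+1+k _ _ _ = ⊥-elim (ℕP.0≢1+n (trans j≡i+1+k (ℕP.+-suc (toℕ i) k)))
transposition-flip-at zero i (Fin.suc b) j≡i+1 f f-inj f-onto =
  subst (λ i′ → parity (invCount (swap i′ (Fin.suc b) ∘ f)) ≡ parity (invCount f) ⁻¹) (sym i≡b)
        (Adjacent.adjacent-flip b f f-inj f-onto)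
  where
  i≡b : i ≡ inject₁ b
  i≡b = FinP.toℕ-injective
          (sym (trans (FinP.toℕ-inject₁ b) (ℕP.suc-injective (trans j≡i+1 (ℕP.+-comm (toℕ i) 1)))))
transposition-flip-at (suc k) {suc n} i (Fin.suc b) j≡i+2+k f f-inj f-onto = begin
  parity (invCount (swap i j ∘ f))
    ≡⟨ cong parity (invCount-cong (λ x → sym (conjugate (f x)))) ⟩
  parity (invCount (swap j′ j ∘ (swap i j′ ∘ (swap j′ j ∘ f))))
    ≡⟨ Adjacent.adjacent-flip b _ g-inj g-onto ⟩
  parity (invCount (swap i j′ ∘ (swap j′ j ∘ f))) ⁻¹
    ≡⟨ cong _⁻¹ (transposition-flip-at k i j′ j′≡i+1+k _ h-inj h-onto) ⟩
  parity (invCount (swap j′ j ∘ f)) ⁻¹ ⁻¹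
    ≡⟨ ⁻¹-involutive _ ⟩
  parity (invCount (swap j′ j ∘ f))
    ≡⟨ Adjacent.adjacent-flip b f f-inj f-onto ⟩
  parity (invCount f) ⁻¹ ∎
  where
  open ≡-Reasoning
  j : Fin (suc n)
  j = Fin.suc b
  j′ : Fin (suc n)
  j′ = inject₁ b
  j′≡i+1+k : toℕ j′ ≡ toℕ i + suc k
  j′≡i+1+k = trans (FinP.toℕ-inject₁ b) (ℕP.suc-injective (trans j≡i+2+k (ℕP.+-suc (toℕ i) (suc k))))
  i≢j′ : i ≢ j′
  i≢j′ i≡j′ =
    ℕP.m≢1+n+m (toℕ i) (trans (cong toℕ i≡j′) (trans j′≡i+1+k (ℕP.+-comm (toℕ i) (suc k))))
  i≢j : i ≢ j
  i≢j i≡j =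
    ℕP.m≢1+n+m (toℕ i) {suc k} (trans (cong toℕ i≡j) (trans j≡i+2+k (ℕP.+-comm (toℕ i) (suc (suc k)))))
  conjugate : ∀ z → swap j′ j (swap i j′ (swap j′ j z)) ≡ swap i j z
  conjugate z = trans (swap-conjugate j′ j i j′ z)
                      (cong₂ (λ x y → swap x y z) (swap-other j′ j i i≢j′ i≢j) (swap-left j′ j))
  h-inj : Inj (swap j′ j ∘ f)
  h-inj = swap∘-inj j′ j f-inj
  h-onto : Onto (swap j′ j ∘ f)
  h-onto = swap∘-onto j′ j f-onto
  g-inj : Inj (swap i j′ ∘ (swap j′ j ∘ f))
  g-inj = swap∘-inj i j′ h-inj
  g-onto : Onto (swap i j′ ∘ (swap j′ j ∘ f))
  g-onto = swap∘-onto i j′ h-onto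

transposition-flip : (i j : Fin n) → i ≢ j → ∀ f → Inj f → Onto f →
                     parity (invCount (swap i j ∘ f)) ≡ parity (invCount f) ⁻¹
transposition-flip i j i≢j f f-inj f-onto with FinP.<-cmp i j
... | tri< i<j _ _ = let k , i+1+k≡j = ℕP.m≤n⇒∃[o]m+o≡n i<j in
  transposition-flip-at k i j (sym (trans (ℕP.+-suc (toℕ i) k) i+1+k≡j)) f f-inj f-onto
... | tri≈ _ i≡j _ = ⊥-elim (i≢j i≡j)
... | tri> _ _ j<i = let k , j+1+k≡i = ℕP.m≤n⇒∃[o]m+o≡n j<i in
  trans (cong parity (invCount-cong (λ x → swap-comm i j (f x))))
        (transposition-flip-at k j i (sym (trans (ℕP.+-suc (toℕ j) k) j+1+k≡i)) f f-inj f-onto)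

τ : ∀ {m} → Fun (suc (suc m))
τ = swap Fin.zero (Fin.suc Fin.zero)

τ-involutive : ∀ {m} (x : Fin (suc (suc m))) → τ (τ x) ≡ x
τ-involutive = swap-involutive _ _

τ-injective : ∀ {m} → Inj (τ {m})
τ-injective = swap-injective _ _

mkGen : ∀ {m} (a b : Fin (suc (suc m))) → a ≢ b → TGen m
mkGen a b a≢b with FinP.<-cmp a b
... | tri< a<b _ _ = (a , b) , a<b
... | tri≈ _ a≡b _ = ⊥-elim (a≢b a≡b)
... | tri> _ _ b<a = (b , a) , b<a

mkGen-eval : ∀ {m} (a b : Fin (suc (suc m))) (a≢b : a ≢ b) x → evalGen (mkGen a b a≢b) x ≡ τ (swap a b x)
mkGen-eval a b a≢b x with FinP.<-cmp a b
... | tri< _ _ _ = refl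
... | tri≈ _ a≡b _ = ⊥-elim (a≢b a≡b)
... | tri> _ _ _ = cong τ (swap-comm b a x)

gen-distinct : ∀ {m} (t : TGen m) → proj₁ (proj₁ t) ≢ proj₂ (proj₁ t)
gen-distinct ((i , j) , i<j) i≡j = FinP.<-irrefl i≡j i<j

prodT-inj : ∀ {m} (ts : List (TGen m)) → Inj (prodT ts)
prodT-inj [] eq = eq
prodT-inj (((i , j) , _) ∷ ts) eq = prodT-inj ts (swap-injective i j (τ-injective eq))

prodT-onto : ∀ {m} (ts : List (TGen m)) → Onto (prodT ts)
prodT-onto [] y = y , refl
prodT-onto (((i , j) , _) ∷ ts) y with prodT-onto ts (swap i j (τ y))
... | x , eq = x , trans (cong (τ ∘ swap i j) eq) (trans (cong τ (swap-involutive i j (τ y))) (τ-involutive y))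

-- Each generator is a product of two transpositions, so it preserves inversion parity.
gen-preserves-parity : ∀ {m} (t : TGen m) (f : Fun (suc (suc m))) → Inj f → Onto f →
                       parity (invCount (evalGen t ∘ f)) ≡ parity (invCount f)
gen-preserves-parity t@((i , j) , _) f f-inj f-onto = begin
  parity (invCount (τ ∘ (swap i j ∘ f)))
    ≡⟨ transposition-flip _ _ (λ ()) _ (swap∘-inj i j f-inj) (swap∘-onto i j f-onto) ⟩
  parity (invCount (swap i j ∘ f)) ⁻¹
    ≡⟨ cong _⁻¹ (transposition-flip i j (gen-distinct t) f f-inj f-onto) ⟩
  parity (invCount f) ⁻¹ ⁻¹
    ≡⟨ ⁻¹-involutive _ ⟩
  parity (invCount f) ∎
  where open ≡-Reasoning

-- The coset representative of parity p: the identity for 0ℙ, and τ for 1ℙ.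
ρ : ∀ {m} → Parity → Fun (suc (suc m))
ρ 0ℙ = id
ρ 1ℙ = τ

prodT-parity : ∀ {m} (ts : List (TGen m)) p → parity (invCount (prodT ts ∘ ρ p)) ≡ p
prodT-parity {m} [] 0ℙ = cong parity (invCount-id (suc (suc m)))
prodT-parity {m} [] 1ℙ =
  trans (transposition-flip {suc (suc m)} Fin.zero (Fin.suc Fin.zero) (λ ()) id (λ eq → eq) (λ y → y , refl))
        (cong (λ k → parity k ⁻¹) (invCount-id (suc (suc m))))
prodT-parity (t ∷ ts) p =
  trans (gen-preserves-parity t (prodT ts ∘ ρ p) (ρ-inj p ∘ prodT-inj ts) (onto-∘ (prodT-onto ts) (ρ-onto p)))
        (prodT-parity ts p)
  where
  ρ-inj : ∀ p → Inj (ρ p)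
  ρ-inj 0ℙ eq = eq
  ρ-inj 1ℙ eq = τ-injective eq
  ρ-onto : ∀ p → Onto (ρ p)
  ρ-onto 0ℙ y = y , refl
  ρ-onto 1ℙ y = τ y , τ-involutive y
  onto-∘ : ∀ {f g : Fun _} → Onto f → Onto g → Onto (f ∘ g)
  onto-∘ {f} f-onto g-onto y with f-onto y
  ... | x , fx with g-onto x
  ...   | z , gz = z , trans (cong f gz) fx

-- The new point is inserted at index 2 (just after
-- the special points 1 and 2); embed includes the old points, retract is a left inverse of
-- embed collapsing the new point onto 0.
module _ {m : ℕ} where

  new : Fin (3 + m)
  new = Fin.suc (Fin.suc Fin.zero)

  embed : Fin (2 + m) → Fin (3 + m)
  embed Fin.zero = Fin.zero
  embed (Fin.suc Fin.zero) = Fin.suc Fin.zero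
  embed (Fin.suc (Fin.suc x)) = Fin.suc (Fin.suc (Fin.suc x))

  retract : Fin (3 + m) → Fin (2 + m)
  retract Fin.zero = Fin.zero
  retract (Fin.suc Fin.zero) = Fin.suc Fin.zero
  retract (Fin.suc (Fin.suc Fin.zero)) = Fin.zero
  retract (Fin.suc (Fin.suc (Fin.suc x))) = Fin.suc (Fin.suc x)

  retract-embed : ∀ x → retract (embed x) ≡ x
  retract-embed Fin.zero = refl
  retract-embed (Fin.suc Fin.zero) = refl
  retract-embed (Fin.suc (Fin.suc x)) = refl

  embed-retract : ∀ y → y ≢ new → embed (retract y) ≡ y
  embed-retract Fin.zero _ = refl
  embed-retract (Fin.suc Fin.zero) _ = refl
  embed-retract (Fin.suc (Fin.suc Fin.zero)) y≢new = ⊥-elim (y≢new refl)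
  embed-retract (Fin.suc (Fin.suc (Fin.suc x))) _ = refl

  embed-inj : Inj embed
  embed-inj {x} {y} eq = trans (sym (retract-embed x)) (trans (cong retract eq) (retract-embed y))

  embed≢new : ∀ x → embed x ≢ new
  embed≢new Fin.zero ()
  embed≢new (Fin.suc Fin.zero) ()
  embed≢new (Fin.suc (Fin.suc x)) ()

  new-or-embed : ∀ y → y ≡ new ⊎ ∃ λ x → y ≡ embed x
  new-or-embed Fin.zero = inj₂ (Fin.zero , refl)
  new-or-embed (Fin.suc Fin.zero) = inj₂ (Fin.suc Fin.zero , refl)
  new-or-embed (Fin.suc (Fin.suc Fin.zero)) = inj₁ refl
  new-or-embed (Fin.suc (Fin.suc (Fin.suc x))) = inj₂ (Fin.suc (Fin.suc x) , refl)

  -- τ moves only the special points 1 and 2, which embed leaves in place.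
  τ-embed : ∀ x → τ (embed x) ≡ embed (τ x)
  τ-embed x = sym (swap-natural embed embed-inj Fin.zero (Fin.suc Fin.zero) x)

  τ≢new : ∀ y → y ≢ new → τ y ≢ new
  τ≢new y y≢new τy≡new = y≢new (τ-injective τy≡new)

  extend : Fun (2 + m) → Fun (3 + m)
  extend f Fin.zero = embed (f Fin.zero)
  extend f (Fin.suc Fin.zero) = embed (f (Fin.suc Fin.zero))
  extend f (Fin.suc (Fin.suc Fin.zero)) = new
  extend f (Fin.suc (Fin.suc (Fin.suc x))) = embed (f (Fin.suc (Fin.suc x)))

  extend-embed : ∀ f x → extend f (embed x) ≡ embed (f x)
  extend-embed f Fin.zero = refl
  extend-embed f (Fin.suc Fin.zero) = refl
  extend-embed f (Fin.suc (Fin.suc x)) = refl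

  extend-unique : ∀ (f : Fun (2 + m)) (g : Fun (3 + m)) → g new ≡ new →
                  (∀ x → g (embed x) ≡ embed (f x)) → ∀ y → extend f y ≡ g y
  extend-unique f g g-new g-embed y with new-or-embed y
  ... | inj₁ refl = sym g-new
  ... | inj₂ (x , refl) = trans (extend-embed f x) (sym (g-embed x))

  extend-cong : ∀ {f g} → (∀ x → f x ≡ g x) → ∀ y → extend f y ≡ extend g y
  extend-cong {f} {g} f≗g = extend-unique f (extend g) refl
    (λ x → trans (extend-embed g x) (cong embed (sym (f≗g x))))

  extend-∘ : ∀ f g y → extend (f ∘ g) y ≡ extend f (extend g y)
  extend-∘ f g = extend-unique (f ∘ g) (extend f ∘ extend g) refl
    (λ x → trans (cong (extend f) (extend-embed g x)) (extend-embed f (g x)))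

  extend-id : ∀ y → extend id y ≡ y
  extend-id = extend-unique id id refl (λ _ → refl)

  extend-τ : ∀ y → extend τ y ≡ τ y
  extend-τ = extend-unique τ τ refl τ-embed

  extend-inj : ∀ f → Inj f → Inj (extend f)
  extend-inj f f-inj {y₁} {y₂} eq with new-or-embed y₁ | new-or-embed y₂
  ... | inj₁ refl | inj₁ refl = refl
  ... | inj₁ refl | inj₂ (x₂ , refl) = ⊥-elim (embed≢new (f x₂) (sym (trans eq (extend-embed f x₂))))
  ... | inj₂ (x₁ , refl) | inj₁ refl = ⊥-elim (embed≢new (f x₁) (trans (sym (extend-embed f x₁)) eq))
  ... | inj₂ (x₁ , refl) | inj₂ (x₂ , refl) =
    cong embed (f-inj (embed-inj (trans (sym (extend-embed f x₁)) (trans eq (extend-embed f x₂)))))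

  extend-gen : ∀ a b y → extend (τ ∘ swap a b) y ≡ τ (swap (embed a) (embed b) y)
  extend-gen a b = extend-unique (τ ∘ swap a b) (τ ∘ swap (embed a) (embed b))
    (cong τ (swap-other (embed a) (embed b) new (embed≢new a ∘ sym) (embed≢new b ∘ sym)))
    (λ x → trans (cong τ (sym (swap-natural embed embed-inj a b x))) (τ-embed (swap a b x)))

  -- mover p is an element of length ≤ 1 sending p to the new point: the identity if p is
  -- new, and the generator (1 2)(p new) otherwise; weight p is its length.
  mover : Fin (3 + m) → Fun (3 + m)
  mover p with p ≟ new
  ... | yes _ = id
  ... | no _ = τ ∘ swap p new

  mover⁻¹ : Fin (3 + m) → Fun (3 + m)
  mover⁻¹ p with p ≟ new
  ... | yes _ = id
  ... | no _ = swap p new ∘ τ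

  weight : Fin (3 + m) → ℕ
  weight p with p ≟ new
  ... | yes _ = 0
  ... | no _ = 1

  mover-sends : ∀ p → mover p p ≡ new
  mover-sends p with p ≟ new
  ... | yes p≡new = p≡new
  ... | no _ = cong τ (swap-left p new)

  mover⁻¹-new : ∀ p → mover⁻¹ p new ≡ p
  mover⁻¹-new p with p ≟ new
  ... | yes p≡new = sym p≡new
  ... | no _ = swap-right p new

  mover-mover⁻¹ : ∀ p x → mover p (mover⁻¹ p x) ≡ x
  mover-mover⁻¹ p x with p ≟ new
  ... | yes _ = refl
  ... | no _ = trans (cong τ (swap-involutive p new (τ x))) (τ-involutive x)

  mover⁻¹-mover : ∀ p x → mover⁻¹ p (mover p x) ≡ x
  mover⁻¹-mover p x with p ≟ new
  ... | yes _ = refl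
  ... | no _ = trans (cong (swap p new) (τ-involutive (swap p new x))) (swap-involutive p new x)

  mover-inj : ∀ p → Inj (mover p)
  mover-inj p {x} {y} eq = trans (sym (mover⁻¹-mover p x)) (trans (cong (mover⁻¹ p) eq) (mover⁻¹-mover p y))

  mover⁻¹-inj : ∀ p → Inj (mover⁻¹ p)
  mover⁻¹-inj p {x} {y} eq = trans (sym (mover-mover⁻¹ p x)) (trans (cong (mover p) eq) (mover-mover⁻¹ p y))

  mover-at-new : ∀ p → p ≡ new → ∀ x → mover p x ≡ x
  mover-at-new p p≡new x with p ≟ new
  ... | yes _ = refl
  ... | no p≢new = ⊥-elim (p≢new p≡new)

  mover-off-new : ∀ p → p ≢ new → ∀ x → mover p x ≡ τ (swap p new x)
  mover-off-new p p≢new x with p ≟ new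
  ... | yes p≡new = ⊥-elim (p≢new p≡new)
  ... | no _ = refl

  mover⁻¹-at-new : ∀ p → p ≡ new → ∀ x → mover⁻¹ p x ≡ x
  mover⁻¹-at-new p p≡new x with p ≟ new
  ... | yes _ = refl
  ... | no p≢new = ⊥-elim (p≢new p≡new)

  mover⁻¹-off-new : ∀ p → p ≢ new → ∀ x → mover⁻¹ p x ≡ swap p new (τ x)
  mover⁻¹-off-new p p≢new x with p ≟ new
  ... | yes p≡new = ⊥-elim (p≢new p≡new)
  ... | no _ = refl

  weight-at-new : ∀ p → p ≡ new → weight p ≡ 0
  weight-at-new p p≡new with p ≟ new
  ... | yes _ = refl
  ... | no p≢new = ⊥-elim (p≢new p≡new)

  weight-off-new : ∀ p → p ≢ new → weight p ≡ 1
  weight-off-new p p≢new with p ≟ new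
  ... | yes p≡new = ⊥-elim (p≢new p≡new)
  ... | no _ = refl

  mover⁻¹-gen : ∀ p (p≢new : p ≢ new) x → mover⁻¹ p x ≡ evalGen (mkGen (τ p) new (τ≢new p p≢new)) x
  mover⁻¹-gen p p≢new x = begin
    mover⁻¹ p x                  ≡⟨ mover⁻¹-off-new p p≢new x ⟩
    swap p new (τ x)             ≡⟨ sym (τ-involutive _) ⟩
    τ (τ (swap p new (τ x)))     ≡⟨ cong τ (swap-conjugate Fin.zero (Fin.suc Fin.zero) p new x) ⟩
    τ (swap (τ p) new x)         ≡⟨ sym (mkGen-eval (τ p) new _ x) ⟩
    evalGen (mkGen (τ p) new (τ≢new p p≢new)) x ∎
    where open ≡-Reasoning

  reduce : Fun (3 + m) → Fun (2 + m)
  reduce f x = retract (mover (f new) (f (embed x)))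

  mover-f-embed≢new : ∀ f → Inj f → ∀ x → mover (f new) (f (embed x)) ≢ new
  mover-f-embed≢new f f-inj x eq =
    embed≢new x (f-inj (mover-inj (f new) (trans eq (sym (mover-sends (f new))))))

  embed-reduce : ∀ f → Inj f → ∀ x → embed (reduce f x) ≡ mover (f new) (f (embed x))
  embed-reduce f f-inj x = embed-retract _ (mover-f-embed≢new f f-inj x)

  reduce-inj : ∀ f → Inj f → Inj (reduce f)
  reduce-inj f f-inj {x} {y} eq = embed-inj (f-inj (mover-inj (f new)
    (trans (sym (embed-reduce f f-inj x)) (trans (cong embed eq) (embed-reduce f f-inj y)))))

  reduce-cong : ∀ {f g} → (∀ x → f x ≡ g x) → ∀ x → reduce f x ≡ reduce g x
  reduce-cong f≗g x = cong₂ (λ p y → retract (mover p y)) (f≗g new) (f≗g (embed x))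

  reconstruct : ∀ f → Inj f → ∀ y → f y ≡ mover⁻¹ (f new) (extend (reduce f) y)
  reconstruct f f-inj y = sym (reassembled y)
    where
    reassembled : ∀ y → mover⁻¹ (f new) (extend (reduce f) y) ≡ f y
    reassembled y with new-or-embed y
    ... | inj₁ refl = mover⁻¹-new (f new)
    ... | inj₂ (x , refl) = begin
      mover⁻¹ (f new) (extend (reduce f) (embed x)) ≡⟨ cong (mover⁻¹ (f new)) (extend-embed (reduce f) x) ⟩
      mover⁻¹ (f new) (embed (reduce f x))          ≡⟨ cong (mover⁻¹ (f new)) (embed-reduce f f-inj x) ⟩
      mover⁻¹ (f new) (mover (f new) (f (embed x))) ≡⟨ mover⁻¹-mover (f new) _ ⟩
      f (embed x)                                   ∎
      where open ≡-Reasoning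

-- The depth of a permutation of m + 2 points: the sum of the weights met while reducing it
-- down to two points.  It will turn out to be the length ℓ_T.
depth : ∀ m → Fun (2 + m) → ℕ
depth zero f = 0
depth (suc m) f = weight (f new) + depth m (reduce f)

depth-cong : ∀ m {f g} → (∀ x → f x ≡ g x) → depth m f ≡ depth m g
depth-cong zero f≗g = refl
depth-cong (suc m) f≗g = cong₂ _+_ (cong weight (f≗g new)) (depth-cong m (reduce-cong f≗g))

extendGen : ∀ {m} → TGen m → TGen (suc m)
extendGen ((i , j) , i<j) = mkGen (embed i) (embed j) (λ eq → FinP.<-irrefl (embed-inj eq) i<j)

extendGen-eval : ∀ {m} (t : TGen m) y → evalGen (extendGen t) y ≡ extend (evalGen t) y
extendGen-eval ((i , j) , _) y = trans (mkGen-eval (embed i) (embed j) _ y) (sym (extend-gen i j y))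

extend-prodT : ∀ {m} (ts : List (TGen m)) y → extend (prodT ts) y ≡ prodT (map extendGen ts) y
extend-prodT [] y = extend-id y
extend-prodT (t ∷ ts) y = trans (extend-∘ (evalGen t) (prodT ts) y)
  (trans (sym (extendGen-eval t (extend (prodT ts) y))) (cong (evalGen (extendGen t)) (extend-prodT ts y)))

extend-ρ : ∀ {m} p y → extend {m} (ρ p) y ≡ ρ p y
extend-ρ 0ℙ = extend-id
extend-ρ 1ℙ = extend-τ

Factorisation : ∀ m → Fun (2 + m) → Set
Factorisation m f = ∃ λ (ts : List (TGen m)) → ∃ λ (p : Parity) →
  length ts ≡ depth m f × (∀ x → f x ≡ prodT ts (ρ p x))

lift : ∀ {m} (q : Fin (3 + m)) (ts : List (TGen m)) p →
       ∃ λ (ts′ : List (TGen (suc m))) → length ts′ ≡ weight q + length ts ×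
         (∀ y → mover⁻¹ q (extend (prodT ts ∘ ρ p) y) ≡ prodT ts′ (ρ p y))
lift q ts p = by-cases (q ≟ new)
  where
  extended : ∀ y → extend (prodT ts ∘ ρ p) y ≡ prodT (map extendGen ts) (ρ p y)
  extended y = trans (extend-∘ (prodT ts) (ρ p) y)
                     (trans (extend-prodT ts _) (cong (prodT (map extendGen ts)) (extend-ρ p y)))
  by-cases : Dec (q ≡ new) → ∃ λ ts′ → length ts′ ≡ weight q + length ts ×
               (∀ y → mover⁻¹ q (extend (prodT ts ∘ ρ p) y) ≡ prodT ts′ (ρ p y))
  by-cases (yes q≡new) =
    map extendGen ts ,
    trans (length-map extendGen ts) (cong (_+ length ts) (sym (weight-at-new q q≡new))) ,
    λ y → trans (mover⁻¹-at-new q q≡new _) (extended y)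
  by-cases (no q≢new) =
    mkGen (τ q) new (τ≢new q q≢new) ∷ map extendGen ts ,
    trans (cong suc (length-map extendGen ts)) (cong (_+ length ts) (sym (weight-off-new q q≢new))) ,
    λ y → trans (mover⁻¹-gen q q≢new _) (cong (evalGen (mkGen (τ q) new (τ≢new q q≢new))) (extended y))

factorise-two : (f : Fun 2) → Inj f → ∀ u v → f Fin.zero ≡ u → f (Fin.suc Fin.zero) ≡ v →
                Factorisation zero f
factorise-two f f-inj Fin.zero Fin.zero f0 f1 = ⊥-elim (FinP.0≢1+n (f-inj (trans f0 (sym f1))))
factorise-two f f-inj Fin.zero (Fin.suc Fin.zero) f0 f1 =
  [] , 0ℙ , refl , λ { Fin.zero → f0 ; (Fin.suc Fin.zero) → f1 }
factorise-two f f-inj (Fin.suc Fin.zero) Fin.zero f0 f1 =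
  [] , 1ℙ , refl , λ { Fin.zero → f0 ; (Fin.suc Fin.zero) → f1 }
factorise-two f f-inj (Fin.suc Fin.zero) (Fin.suc Fin.zero) f0 f1 = ⊥-elim (FinP.0≢1+n (f-inj (trans f0 (sym f1))))

factorise : ∀ m (f : Fun (2 + m)) → Inj f → Factorisation m f
factorise zero f f-inj = factorise-two f f-inj _ _ refl refl
factorise (suc m) f f-inj with factorise m (reduce f) (reduce-inj f f-inj)
... | ts , p , length≡depth , reduce-f≗ with lift (f new) ts p
...   | ts′ , length′ , lifted =
  ts′ , p , trans length′ (cong (weight (f new) +_) length≡depth) ,
  λ y → trans (reconstruct f f-inj y) (trans (cong (mover⁻¹ (f new)) (extend-cong reduce-f≗ y)) (lifted y))

even-factorisation : ∀ {m} {f : Fun (2 + m)} (ts : List (TGen m)) p → (∀ x → f x ≡ prodT ts (ρ p x)) →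
                     parity (invCount f) ≡ 0ℙ → p ≡ 0ℙ
even-factorisation {f = f} ts p f≗ even =
  trans (sym (prodT-parity ts p)) (trans (cong parity (sym (invCount-cong f≗))) even)

-- Lower bound: a generator raises the depth by at most one.
module _ {m : ℕ} where

  restrictGen : (a b : Fin (3 + m)) → a ≢ new → b ≢ new → a ≢ b →
                ∃ λ (t : TGen m) → ∀ x → retract (swap a b (τ (embed x))) ≡ evalGen t x
  restrictGen a b a≢new b≢new a≢b = mkGen (τ (retract a)) (τ (retract b)) τa≢τb , λ x → begin
      retract (swap a b (τ (embed x)))
        ≡⟨ cong₂ (λ u v → retract (swap u v (τ (embed x))))
                 (sym (embed-retract a a≢new)) (sym (embed-retract b b≢new)) ⟩
      retract (swap (embed (retract a)) (embed (retract b)) (τ (embed x)))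
        ≡⟨ cong (retract ∘ swap (embed (retract a)) (embed (retract b))) (τ-embed x) ⟩
      retract (swap (embed (retract a)) (embed (retract b)) (embed (τ x)))
        ≡⟨ cong retract (sym (swap-natural embed embed-inj (retract a) (retract b) (τ x))) ⟩
      retract (embed (swap (retract a) (retract b) (τ x)))
        ≡⟨ retract-embed _ ⟩
      swap (retract a) (retract b) (τ x)
        ≡⟨ sym (τ-involutive _) ⟩
      τ (τ (swap (retract a) (retract b) (τ x)))
        ≡⟨ cong τ (swap-conjugate Fin.zero (Fin.suc Fin.zero) (retract a) (retract b) x) ⟩
      τ (swap (τ (retract a)) (τ (retract b)) x)
        ≡⟨ sym (mkGen-eval (τ (retract a)) (τ (retract b)) τa≢τb x) ⟩
      evalGen (mkGen (τ (retract a)) (τ (retract b)) τa≢τb) x ∎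
    where
    open ≡-Reasoning
    τa≢τb : τ (retract a) ≢ τ (retract b)
    τa≢τb eq =
      a≢b (trans (sym (embed-retract a a≢new)) (trans (cong embed (τ-injective eq)) (embed-retract b b≢new)))

  -- If f new = p, the generator (1 2)(i j) sends f new to q = τ (swap i j p) and acts on
  -- reduce f by the following residual map.
  residual : (i j p : Fin (3 + m)) → Fun (2 + m)
  residual i j p y = retract (mover (τ (swap i j p)) (τ (swap i j (mover⁻¹ p (embed y)))))

  ResidualStep : (i j p : Fin (3 + m)) → Set
  ResidualStep i j p =
    ((∀ y → residual i j p y ≡ y) × weight (τ (swap i j p)) ≤ suc (weight p)) ⊎
    ((∃ λ t → ∀ y → residual i j p y ≡ evalGen t y) × weight (τ (swap i j p)) ≤ weight p)

  τ-fixes-only-new : ∀ (y : Fin (3 + m)) → τ y ≡ new → y ≡ new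
  τ-fixes-only-new y τy≡new = τ-injective τy≡new

  -- τ (swap u new (τ z)) = swap (τ u) new z, as τ fixes the new point.
  τ-conjugate-new : ∀ (u z : Fin (3 + m)) → τ (swap u new (τ z)) ≡ swap (τ u) new z
  τ-conjugate-new u z = swap-conjugate Fin.zero (Fin.suc Fin.zero) u new z

  -- Case p = new = q: the generator fixes the new point and restricts to a generator.
  step-new-new : ∀ i j p → i ≢ j → p ≡ new → τ (swap i j p) ≡ new → ResidualStep i j p
  step-new-new i j p i≢j p≡new q≡new =
    inj₂ ((proj₁ t , λ y → trans (residual≡ y) (proj₂ t y)) ,
          ℕP.≤-trans (ℕP.≤-reflexive (weight-at-new _ q≡new)) z≤n)
    where
    ijnew≡new : swap i j new ≡ new
    ijnew≡new = τ-fixes-only-new _ (trans (cong (τ ∘ swap i j) (sym p≡new)) q≡new)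
    i≢new : i ≢ new
    i≢new refl = i≢j (sym (trans (sym (swap-left new j)) ijnew≡new))
    j≢new : j ≢ new
    j≢new refl = i≢j (trans (sym (swap-right i new)) ijnew≡new)
    t : ∃ λ (t : TGen m) → ∀ x → retract (swap (τ i) (τ j) (τ (embed x))) ≡ evalGen t x
    t = restrictGen (τ i) (τ j) (τ≢new i i≢new) (τ≢new j j≢new) (i≢j ∘ τ-injective)
    residual≡ : ∀ y → residual i j p y ≡ retract (swap (τ i) (τ j) (τ (embed y)))
    residual≡ y = begin
      retract (mover q (τ (swap i j (mover⁻¹ p (embed y)))))
        ≡⟨ cong retract (mover-at-new q q≡new _) ⟩
      retract (τ (swap i j (mover⁻¹ p (embed y))))
        ≡⟨ cong (retract ∘ τ ∘ swap i j) (mover⁻¹-at-new p p≡new (embed y)) ⟩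
      retract (τ (swap i j (embed y)))
        ≡⟨ cong retract (swap-natural τ τ-injective i j (embed y)) ⟩
      retract (swap (τ i) (τ j) (τ (embed y))) ∎
      where
      open ≡-Reasoning
      q : Fin (3 + m)
      q = τ (swap i j p)

  -- Case p = new ≠ q: the generator is mover⁻¹ q, so the residual map is trivial.
  step-new-old : ∀ i j p → i ≢ j → p ≡ new → τ (swap i j p) ≢ new → ResidualStep i j p
  step-new-old i j p i≢j p≡new q≢new =
    inj₁ (residual≡id , ℕP.≤-trans (ℕP.≤-reflexive (weight-off-new q q≢new)) (s≤s z≤n))
    where
    q : Fin (3 + m)
    q = τ (swap i j p)
    w : Fin (3 + m)
    w = swap i j new
    w≢new : w ≢ new
    w≢new w≡new = q≢new (trans (cong (τ ∘ swap i j) p≡new) (cong τ w≡new))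
    -- (i j) = (w new), as (i j) moves the new point to w
    ij≗w-new : ∀ z → swap i j z ≡ swap w new z
    ij≗w-new z = trans (swap-determined i j new w refl (w≢new ∘ sym) z) (swap-comm new w z)
    residual≡id : ∀ y → residual i j p y ≡ y
    residual≡id y = begin
      retract (mover q (τ (swap i j (mover⁻¹ p (embed y)))))
        ≡⟨ cong retract (mover-off-new q q≢new (τ (swap i j (mover⁻¹ p (embed y))))) ⟩
      retract (τ (swap q new (τ (swap i j (mover⁻¹ p (embed y))))))
        ≡⟨ cong retract (τ-conjugate-new q (swap i j (mover⁻¹ p (embed y)))) ⟩
      retract (swap (τ q) new (swap i j (mover⁻¹ p (embed y))))
        ≡⟨ cong (λ u → retract (swap u new (swap i j (mover⁻¹ p (embed y))))) τq≡w ⟩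
      retract (swap w new (swap i j (mover⁻¹ p (embed y))))
        ≡⟨ cong (retract ∘ swap w new) (ij≗w-new (mover⁻¹ p (embed y))) ⟩
      retract (swap w new (swap w new (mover⁻¹ p (embed y))))
        ≡⟨ cong retract (swap-involutive w new (mover⁻¹ p (embed y))) ⟩
      retract (mover⁻¹ p (embed y))
        ≡⟨ cong retract (mover⁻¹-at-new p p≡new (embed y)) ⟩
      retract (embed y)
        ≡⟨ retract-embed y ⟩
      y ∎
      where
      open ≡-Reasoning
      τq≡w : τ q ≡ w
      τq≡w = trans (τ-involutive _) (cong (swap i j) p≡new)

  -- Case p ≠ new = q: the generator is mover p, so the residual map is trivial.
  step-old-new : ∀ i j p → p ≢ new → τ (swap i j p) ≡ new → ResidualStep i j p
  step-old-new i j p p≢new q≡new =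
    inj₁ (residual≡id , ℕP.≤-trans (ℕP.≤-reflexive (weight-at-new _ q≡new)) z≤n)
    where
    q : Fin (3 + m)
    q = τ (swap i j p)
    -- (i j) = (p new), as (i j) moves p to the new point
    ij≗p-new : ∀ z → swap i j z ≡ swap p new z
    ij≗p-new = swap-determined i j p new (τ-fixes-only-new _ q≡new) p≢new
    residual≡id : ∀ y → residual i j p y ≡ y
    residual≡id y = begin
      retract (mover q (τ (swap i j (mover⁻¹ p (embed y)))))
        ≡⟨ cong retract (mover-at-new q q≡new _) ⟩
      retract (τ (swap i j (mover⁻¹ p (embed y))))
        ≡⟨ cong (retract ∘ τ ∘ swap i j) (mover⁻¹-off-new p p≢new (embed y)) ⟩
      retract (τ (swap i j (swap p new (τ (embed y)))))
        ≡⟨ cong (retract ∘ τ) (ij≗p-new (swap p new (τ (embed y)))) ⟩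
      retract (τ (swap p new (swap p new (τ (embed y)))))
        ≡⟨ cong (retract ∘ τ) (swap-involutive p new (τ (embed y))) ⟩
      retract (τ (τ (embed y)))
        ≡⟨ cong retract (τ-involutive (embed y)) ⟩
      retract (embed y)
        ≡⟨ retract-embed y ⟩
      y ∎
      where open ≡-Reasoning

  -- Case p ≠ new ≠ q: the residual map comes from σ = (p′ new)(i j)(p new), p′ = swap i j p,
  -- which is a transposition of two old points, hence a generator after restriction.
  step-old-old : ∀ i j p → i ≢ j → p ≢ new → τ (swap i j p) ≢ new → ResidualStep i j p
  step-old-old i j p i≢j p≢new q≢new =
    inj₂ (generator , ℕP.≤-reflexive (trans (weight-off-new q q≢new) (sym (weight-off-new p p≢new))))
    where
    open ≡-Reasoning
    q : Fin (3 + m)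
    q = τ (swap i j p)
    p′ : Fin (3 + m)
    p′ = swap i j p
    p′≢new : p′ ≢ new
    p′≢new p′≡new = q≢new (cong τ p′≡new)
    σ : Fun (3 + m)
    σ z = swap p′ new (swap i j (swap p new z))
    residual≡ : ∀ y → residual i j p y ≡ retract (σ (τ (embed y)))
    residual≡ y = begin
      retract (mover q (τ (swap i j (mover⁻¹ p (embed y)))))
        ≡⟨ cong retract (mover-off-new q q≢new (τ (swap i j (mover⁻¹ p (embed y))))) ⟩
      retract (τ (swap q new (τ (swap i j (mover⁻¹ p (embed y))))))
        ≡⟨ cong retract (τ-conjugate-new q (swap i j (mover⁻¹ p (embed y)))) ⟩
      retract (swap (τ q) new (swap i j (mover⁻¹ p (embed y))))
        ≡⟨ cong (λ u → retract (swap u new (swap i j (mover⁻¹ p (embed y))))) (τ-involutive p′) ⟩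
      retract (swap p′ new (swap i j (mover⁻¹ p (embed y))))
        ≡⟨ cong (retract ∘ swap p′ new ∘ swap i j) (mover⁻¹-off-new p p≢new (embed y)) ⟩
      retract (σ (τ (embed y))) ∎
    OldTransposition : Set
    OldTransposition = ∃ λ a → ∃ λ b → a ≢ new × b ≢ new × a ≢ b × (∀ z → σ z ≡ swap a b z)
    σ-transposition : Dec (new ≡ i) → Dec (new ≡ j) → OldTransposition
    σ-transposition (no new≢i) (no new≢j) = i , j , new≢i ∘ sym , new≢j ∘ sym , i≢j , λ z →
      trans (cong (swap p′ new) (swap-conjugate-fixing i j p new z new≢i new≢j))
            (swap-involutive p′ new (swap i j z))
    σ-transposition (yes refl) _ = p , j , p≢new , i≢j ∘ sym , p≢j , λ z → begin
      swap p′ new (swap new j (swap p new z))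
        ≡⟨ cong (λ u → swap u new (swap new j (swap p new z))) p′≡p ⟩
      swap p new (swap new j (swap p new z))
        ≡⟨ swap-conjugate p new new j z ⟩
      swap (swap p new new) (swap p new j) z
        ≡⟨ cong₂ (λ u v → swap u v z) (swap-right p new) (swap-other p new j (p≢j ∘ sym) (i≢j ∘ sym)) ⟩
      swap p j z ∎
      where
      p≢j : p ≢ j
      p≢j refl = p′≢new (swap-right new p)
      p′≡p : p′ ≡ p
      p′≡p = swap-other new j p p≢new p≢j
    σ-transposition (no new≢i) (yes refl) = i , p , new≢i ∘ sym , p≢new , p≢i ∘ sym , λ z → begin
      swap p′ new (swap i new (swap p new z))
        ≡⟨ cong (λ u → swap u new (swap i new (swap p new z))) p′≡p ⟩
      swap p new (swap i new (swap p new z))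
        ≡⟨ swap-conjugate p new i new z ⟩
      swap (swap p new i) (swap p new new) z
        ≡⟨ cong₂ (λ u v → swap u v z) (swap-other p new i (p≢i ∘ sym) (new≢i ∘ sym)) (swap-right p new) ⟩
      swap i p z ∎
      where
      p≢i : p ≢ i
      p≢i refl = p′≢new (swap-left p new)
      p′≡p : p′ ≡ p
      p′≡p = swap-other i new p p≢i p≢new
    generator : ∃ λ (t : TGen m) → ∀ y → residual i j p y ≡ evalGen t y
    generator with σ-transposition (new ≟ i) (new ≟ j)
    ... | a , b , a≢new , b≢new , a≢b , σ≗ab with restrictGen a b a≢new b≢new a≢b
    ...   | t , restricted = t , λ y → trans (residual≡ y) (trans (cong retract (σ≗ab (τ (embed y)))) (restricted y))

  residual-step : ∀ i j p → i ≢ j → ResidualStep i j p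
  residual-step i j p i≢j = by-cases (p ≟ new) (τ (swap i j p) ≟ new)
    where
    by-cases : Dec (p ≡ new) → Dec (τ (swap i j p) ≡ new) → ResidualStep i j p
    by-cases (yes p≡new) (yes q≡new) = step-new-new i j p i≢j p≡new q≡new
    by-cases (yes p≡new) (no q≢new) = step-new-old i j p i≢j p≡new q≢new
    by-cases (no p≢new) (yes q≡new) = step-old-new i j p p≢new q≡new
    by-cases (no p≢new) (no q≢new) = step-old-old i j p i≢j p≢new q≢new

reduce-gen : ∀ {m} (i j : Fin (3 + m)) (f : Fun (3 + m)) → Inj f →
             ∀ x → reduce (τ ∘ swap i j ∘ f) x ≡ residual i j (f new) (reduce f x)
reduce-gen i j f f-inj x = cong (λ u → retract (mover (τ (swap i j (f new))) (τ (swap i j u)))) (sym f-embed)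
  where
  f-embed : mover⁻¹ (f new) (embed (reduce f x)) ≡ f (embed x)
  f-embed = trans (cong (mover⁻¹ (f new)) (embed-reduce f f-inj x)) (mover⁻¹-mover (f new) (f (embed x)))

depth-gen : ∀ m (t : TGen m) (f : Fun (2 + m)) → Inj f → depth m (evalGen t ∘ f) ≤ suc (depth m f)
depth-gen zero t f f-inj = z≤n
depth-gen (suc m) t@((i , j) , _) f f-inj with residual-step i j (f new) (gen-distinct t)
... | inj₁ (trivial , weight≤) = begin
  weight q + depth m (reduce (evalGen t ∘ f))
    ≡⟨ cong (weight q +_) (depth-cong m (λ x → trans (reduce-gen i j f f-inj x) (trivial _))) ⟩
  weight q + depth m (reduce f)
    ≤⟨ ℕP.+-monoˡ-≤ _ weight≤ ⟩
  suc (weight (f new) + depth m (reduce f)) ∎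
  where
  open ℕP.≤-Reasoning
  q : Fin (3 + m)
  q = τ (swap i j (f new))
... | inj₂ ((t′ , is-t′) , weight≤) = begin
  weight q + depth m (reduce (evalGen t ∘ f))
    ≡⟨ cong (weight q +_) (depth-cong m (λ x → trans (reduce-gen i j f f-inj x) (is-t′ _))) ⟩
  weight q + depth m (evalGen t′ ∘ reduce f)
    ≤⟨ ℕP.+-mono-≤ weight≤ (depth-gen m t′ (reduce f) (reduce-inj f f-inj)) ⟩
  weight (f new) + suc (depth m (reduce f))
    ≡⟨ ℕP.+-suc (weight (f new)) _ ⟩
  suc (weight (f new) + depth m (reduce f)) ∎
  where
  open ℕP.≤-Reasoning
  q : Fin (3 + m)
  q = τ (swap i j (f new))

depth-id : ∀ m → depth m id ≡ 0
depth-id zero = refl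
depth-id (suc m) = cong₂ _+_ (weight-at-new {m} new refl)
  (trans (depth-cong m (λ x → trans (cong retract (mover-at-new {m} new refl (embed x))) (retract-embed x))) (depth-id m))

depth-prodT : ∀ m (ts : List (TGen m)) → depth m (prodT ts) ≤ length ts
depth-prodT m [] = ℕP.≤-reflexive (depth-id m)
depth-prodT m (t ∷ ts) = ℕP.≤-trans (depth-gen m t (prodT ts) (prodT-inj ts)) (s≤s (depth-prodT m ts))

IsPerm⇒Inj : (v : Word n) → IsPerm v → Inj (lookup v)
IsPerm⇒Inj v perm {x} {y} = perm x y

even-parity : (v : Word n) → InAlt v → parity (invCount (lookup v)) ≡ 0ℙ
even-parity v (_ , even) = %2≡0⇒parity (inversions v) even

depth-isProd : ∀ m (v : Word (2 + m)) → InAlt v → IsProdOf v (depth m (lookup v))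
depth-isProd m v alt@(perm , _) with factorise m (lookup v) (IsPerm⇒Inj v perm)
... | ts , p , length≡depth , v≗ with even-factorisation ts p v≗ (even-parity v alt)
...   | refl = ts , length≡depth , λ x → sym (v≗ x)

depth-minimal : ∀ m (v : Word (2 + m)) j → IsProdOf v j → depth m (lookup v) ≤ j
depth-minimal m v j (ts , refl , ts≗v) =
  ℕP.≤-trans (ℕP.≤-reflexive (depth-cong m (λ x → sym (ts≗v x)))) (depth-prodT m ts)

HasLength⇒depth : ∀ m (v : Word (2 + m)) k → InAlt v → HasLength v k → depth m (lookup v) ≡ k
HasLength⇒depth m v k alt (prod-k , minimal) with ℕP.m≤n⇒m<n∨m≡n (depth-minimal m v k prod-k)
... | inj₁ depth<k = ⊥-elim (minimal _ depth<k (depth-isProd m v alt))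
... | inj₂ depth≡k = depth≡k

depth⇒HasLength : ∀ m (v : Word (2 + m)) k → InAlt v → depth m (lookup v) ≡ k → HasLength v k
depth⇒HasLength m v k alt refl = depth-isProd m v alt , λ j j<k prod-j → ℕP.<⇒≱ j<k (depth-minimal m v j prod-j)

vec-ext : ∀ {A : Set} {u v : Vec A n} → (∀ x → lookup u x ≡ lookup v x) → u ≡ v
vec-ext {u = u} {v} u≗v = trans (sym (tabulate∘lookup u)) (trans (tabulate-cong u≗v) (tabulate∘lookup v))

-- build q u is the permutation f with f new = q and reduce f = u; every permutation of
-- m + 3 points arises this way exactly once.
module _ {m : ℕ} where

  build : Fin (3 + m) → Word (2 + m) → Word (3 + m)
  build q u = Vec.tabulate (mover⁻¹ q ∘ extend (lookup u))

  lookup-build : ∀ q (u : Word (2 + m)) y → lookup (build q u) y ≡ mover⁻¹ q (extend (lookup u) y)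
  lookup-build q u = lookup∘tabulate (mover⁻¹ q ∘ extend (lookup u))

  build-new : ∀ q (u : Word (2 + m)) → lookup (build q u) new ≡ q
  build-new q u = trans (lookup-build q u new) (mover⁻¹-new q)

  reduce-build : ∀ q (u : Word (2 + m)) x → reduce (lookup (build q u)) x ≡ lookup u x
  reduce-build q u x = begin
    retract (mover (lookup (build q u) new) (lookup (build q u) (embed x)))
      ≡⟨ cong₂ (λ p y → retract (mover p y)) (build-new q u) (lookup-build q u (embed x)) ⟩
    retract (mover q (mover⁻¹ q (extend (lookup u) (embed x))))
      ≡⟨ cong retract (mover-mover⁻¹ q _) ⟩
    retract (extend (lookup u) (embed x))
      ≡⟨ cong retract (extend-embed (lookup u) x) ⟩
    retract (embed (lookup u x))
      ≡⟨ retract-embed _ ⟩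
    lookup u x ∎
    where open ≡-Reasoning

  build-inj : ∀ q {u u′ : Word (2 + m)} → build q u ≡ build q u′ → u ≡ u′
  build-inj q {u} {u′} eq = vec-ext λ x →
    trans (sym (reduce-build q u x)) (trans (cong (λ w → reduce (lookup w) x) eq) (reduce-build q u′ x))

  build-reduce : (v : Word (3 + m)) → IsPerm v → v ≡ build (lookup v new) (Vec.tabulate (reduce (lookup v)))
  build-reduce v perm = vec-ext λ y → begin
    lookup v y
      ≡⟨ reconstruct (lookup v) (IsPerm⇒Inj v perm) y ⟩
    mover⁻¹ (lookup v new) (extend (reduce (lookup v)) y)
      ≡⟨ cong (mover⁻¹ (lookup v new)) (extend-cong (λ x → sym (lookup∘tabulate (reduce (lookup v)) x)) y) ⟩
    mover⁻¹ (lookup v new) (extend (lookup (Vec.tabulate (reduce (lookup v)))) y)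
      ≡⟨ sym (lookup-build (lookup v new) (Vec.tabulate (reduce (lookup v))) y) ⟩
    lookup (build (lookup v new) (Vec.tabulate (reduce (lookup v)))) y ∎
    where open ≡-Reasoning

  build-perm : ∀ q (u : Word (2 + m)) → IsPerm u → IsPerm (build q u)
  build-perm q u perm i j eq = extend-inj (lookup u) (IsPerm⇒Inj u perm)
    (mover⁻¹-inj q (trans (sym (lookup-build q u i)) (trans eq (lookup-build q u j))))

  -- build preserves the inversion parity: both u and build q u factor through ρ of the same parity.
  build-parity : ∀ q (u : Word (2 + m)) → IsPerm u →
                 parity (invCount (lookup (build q u))) ≡ parity (invCount (lookup u))
  build-parity q u perm with factorise m (lookup u) (IsPerm⇒Inj u perm)
  ... | ts , p , _ , u≗ with lift q ts p
  ...   | ts′ , _ , lifted = begin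
    parity (invCount (lookup (build q u)))   ≡⟨ cong parity (invCount-cong build≗) ⟩
    parity (invCount (prodT ts′ ∘ ρ p))       ≡⟨ prodT-parity ts′ p ⟩
    p                                        ≡⟨ sym (prodT-parity ts p) ⟩
    parity (invCount (prodT ts ∘ ρ p))        ≡⟨ cong parity (invCount-cong (λ x → sym (u≗ x))) ⟩
    parity (invCount (lookup u))             ∎
    where
    open ≡-Reasoning
    build≗ : ∀ y → lookup (build q u) y ≡ prodT ts′ (ρ p y)
    build≗ y = trans (lookup-build q u y) (trans (cong (mover⁻¹ q) (extend-cong u≗ y)) (lifted y))

  build-alt : ∀ q (u : Word (2 + m)) → InAlt u → InAlt (build q u)
  build-alt q u alt@(perm , _) = build-perm q u perm ,
    parity⇒%2≡0 (inversions (build q u)) (trans (build-parity q u perm) (even-parity u alt))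

  depth-build : ∀ q (u : Word (2 + m)) → depth (suc m) (lookup (build q u)) ≡ weight q + depth m (lookup u)
  depth-build q u = cong₂ _+_ (cong weight (build-new q u)) (depth-cong m (reduce-build q u))

-- shift L w k is the list L (k ∸ w), and is empty when k < w.
shift : {A : Set} → (ℕ → List A) → ℕ → ℕ → List A
shift L zero k = L k
shift L (suc w) zero = []
shift L (suc w) (suc k) = shift L w k

module _ {A : Set} (L : ℕ → List A) where

  ∈-shift⁻ : ∀ {u} w k → u ∈ shift L w k → ∃ λ k′ → k ≡ w + k′ × u ∈ L k′
  ∈-shift⁻ zero k u∈ = k , refl , u∈
  ∈-shift⁻ (suc w) (suc k) u∈ with ∈-shift⁻ w k u∈
  ... | k′ , refl , u∈′ = k′ , refl , u∈′

  ∈-shift⁺ : ∀ {u} w k′ → u ∈ L k′ → u ∈ shift L w (w + k′)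
  ∈-shift⁺ zero k′ u∈ = u∈
  ∈-shift⁺ (suc w) k′ u∈ = ∈-shift⁺ w k′ u∈

  shift-unique : (∀ k → Unique (L k)) → ∀ w k → Unique (shift L w k)
  shift-unique L-unique zero k = L-unique k
  shift-unique L-unique (suc w) zero = []
  shift-unique L-unique (suc w) (suc k) = shift-unique L-unique w k

-- Given the lists L k′ of even permutations of depth k′ on m + 2 points, the even permutations
-- of depth k on m + 3 points with f new ∈ qs are the build q u with u ∈ L (k ∸ weight q).
module _ {m : ℕ} (L : ℕ → List (Word (2 + m))) (k : ℕ) where

  blocks : List (Fin (3 + m)) → List (Word (3 + m))
  blocks [] = []
  blocks (q ∷ qs) = map (build q) (shift L (weight q) k) ++ blocks qs

  ∈-blocks⁻ : ∀ qs {v} → v ∈ blocks qs →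
              ∃ λ q → q ∈ qs × ∃ λ u → u ∈ shift L (weight q) k × v ≡ build q u
  ∈-blocks⁻ (q ∷ qs) v∈ with ∈-++⁻ (map (build q) (shift L (weight q) k)) v∈
  ... | inj₁ v∈block with ∈-map⁻ (build q) v∈block
  ...   | u , u∈ , v≡ = q , here refl , u , u∈ , v≡
  ∈-blocks⁻ (q ∷ qs) v∈ | inj₂ v∈rest with ∈-blocks⁻ qs v∈rest
  ...   | q′ , q′∈ , rest = q′ , there q′∈ , rest

  ∈-blocks⁺ : ∀ qs {q u} → q ∈ qs → u ∈ shift L (weight q) k → build q u ∈ blocks qs
  ∈-blocks⁺ (q ∷ qs) (here refl) u∈ = ∈-++⁺ˡ (∈-map⁺ (build q) u∈)
  ∈-blocks⁺ (q′ ∷ qs) (there q∈) u∈ =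
    ∈-++⁺ʳ (map (build q′) (shift L (weight q′) k)) (∈-blocks⁺ qs q∈ u∈)

  -- Blocks for distinct q are disjoint, since q = (build q u) new.
  blocks-unique : ∀ qs → Unique qs → (∀ k′ → Unique (L k′)) → Unique (blocks qs)
  blocks-unique [] _ _ = []
  blocks-unique (q ∷ qs) (q∉qs ∷ qs-unique) L-unique =
    ++⁺ (map⁺ (build-inj q) (shift-unique L L-unique (weight q) k)) (blocks-unique qs qs-unique L-unique) disjoint
    where
    disjoint : ∀ {v} → ¬ (v ∈ map (build q) (shift L (weight q) k) × v ∈ blocks qs)
    disjoint (v∈block , v∈rest) with ∈-map⁻ (build q) v∈block | ∈-blocks⁻ qs v∈rest
    ... | u , _ , refl | q′ , q′∈ , u′ , _ , eq =
      All.lookup q∉qs q′∈ (trans (sym (build-new q u)) (trans (cong (λ w → lookup w new) eq) (build-new q′ u′)))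

  blocks-length-cons : ∀ q qs → length (blocks (q ∷ qs)) ≡ length (shift L (weight q) k) + length (blocks qs)
  blocks-length-cons q qs = trans (length-++ (map (build q) (shift L (weight q) k)))
                                  (cong (_+ length (blocks qs)) (length-map (build q) (shift L (weight q) k)))

  -- All old points have weight one.
  blocks-length-old : ∀ n (h : Fin n → Fin (3 + m)) → (∀ x → h x ≢ new) →
                      length (blocks (List.tabulate h)) ≡ n * length (shift L 1 k)
  blocks-length-old zero h _ = refl
  blocks-length-old (suc n) h h≢new = trans (blocks-length-cons (h Fin.zero) (List.tabulate (h ∘ Fin.suc)))
    (cong₂ _+_ (cong (λ w → length (shift L w k)) (weight-off-new _ (h≢new Fin.zero)))
               (blocks-length-old n (h ∘ Fin.suc) (h≢new ∘ Fin.suc)))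

  -- The points are 0, 1 (weight 1), new (weight 0), and m further points of weight 1.
  blocks-length : length (blocks (allFin (3 + m))) ≡
                  length (shift L 1 k) + (length (shift L 1 k) + (length (L k) + m * length (shift L 1 k)))
  blocks-length = begin
    length (blocks (allFin (3 + m)))
      ≡⟨ blocks-length-cons Fin.zero (List.tabulate Fin.suc) ⟩
    s₁ + length (blocks (List.tabulate Fin.suc))
      ≡⟨ cong (s₁ +_) (blocks-length-cons (Fin.suc Fin.zero) (List.tabulate (Fin.suc ∘ Fin.suc))) ⟩
    s₁ + (s₁ + length (blocks (List.tabulate (Fin.suc ∘ Fin.suc))))
      ≡⟨ cong (λ z → s₁ + (s₁ + z)) (blocks-length-cons new (List.tabulate old)) ⟩
    s₁ + (s₁ + (length (L k) + length (blocks (List.tabulate old))))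
      ≡⟨ cong (λ z → s₁ + (s₁ + (length (L k) + z))) (blocks-length-old m old (λ x ())) ⟩
    s₁ + (s₁ + (length (L k) + m * s₁)) ∎
    where
    open ≡-Reasoning
    s₁ : ℕ
    s₁ = length (shift L 1 k)
    old : Fin m → Fin (3 + m)
    old x = Fin.suc (Fin.suc (Fin.suc x))

EvenOfDepth : ∀ m → ℕ → Word (2 + m) → Set
EvenOfDepth m k v = InAlt v × depth m (lookup v) ≡ k

enumerate : ∀ m → ℕ → List (Word (2 + m))
enumerate zero zero = Vec.tabulate id ∷ []
enumerate zero (suc k) = []
enumerate (suc m) k = blocks (enumerate m) k (allFin (3 + m))

enumerate-unique : ∀ m k → Unique (enumerate m k)
enumerate-unique zero zero = [] ∷ []
enumerate-unique zero (suc k) = []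
enumerate-unique (suc m) k = blocks-unique (enumerate m) k (allFin (3 + m)) (allFin⁺ (3 + m)) (enumerate-unique m)

enumerate-sound : ∀ m k {v} → v ∈ enumerate m k → EvenOfDepth m k v
enumerate-sound zero zero (here refl) = (identity-perm , refl) , refl
  where
  identity-perm : IsPerm (Vec.tabulate {n = 2} id)
  identity-perm i j eq = trans (sym (lookup∘tabulate id i)) (trans eq (lookup∘tabulate id j))
enumerate-sound (suc m) k v∈ with ∈-blocks⁻ (enumerate m) k (allFin (3 + m)) v∈
... | q , _ , u , u∈ , refl with ∈-shift⁻ (enumerate m) (weight q) k u∈
...   | k′ , refl , u∈′ with enumerate-sound m k′ u∈′
...     | u-alt , refl = build-alt q u u-alt , depth-build q u

enumerate-complete : ∀ m k v → EvenOfDepth m k v → v ∈ enumerate m k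
enumerate-complete zero k v (alt@(perm , _) , depth≡k)
  with factorise zero (lookup v) (IsPerm⇒Inj v perm)
... | [] , p , _ , v≗ with even-factorisation [] p v≗ (even-parity v alt) | depth≡k
...   | refl | refl = here (vec-ext λ x → trans (v≗ x) (sym (lookup∘tabulate id x)))
enumerate-complete (suc m) k v (alt@(perm , _) , depth≡k) =
  subst (_∈ enumerate (suc m) k) (sym v≡) (∈-blocks⁺ (enumerate m) k (allFin (3 + m)) (∈-allFin q) u∈)
  where
  q : Fin (3 + m)
  q = lookup v new
  u : Word (2 + m)
  u = Vec.tabulate (reduce (lookup v))
  lookup-u : ∀ x → lookup u x ≡ reduce (lookup v) x
  lookup-u = lookup∘tabulate (reduce (lookup v))
  u-perm : IsPerm u
  u-perm i j eq = reduce-inj (lookup v) (IsPerm⇒Inj v perm) (trans (sym (lookup-u i)) (trans eq (lookup-u j)))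
  v≡ : v ≡ build q u
  v≡ = build-reduce v perm
  u-even : parity (invCount (lookup u)) ≡ 0ℙ
  u-even = trans (sym (build-parity q u u-perm))
                 (trans (cong (parity ∘ invCount ∘ lookup) (sym v≡)) (even-parity v alt))
  u-alt : InAlt u
  u-alt = u-perm , parity⇒%2≡0 (inversions u) u-even
  depth-u : weight q + depth m (lookup u) ≡ k
  depth-u = trans (cong (weight q +_) (depth-cong m lookup-u)) depth≡k
  u∈ : u ∈ shift (enumerate m) (weight q) k
  u∈ = subst (λ k′ → u ∈ shift (enumerate m) (weight q) k′) depth-u
         (∈-shift⁺ (enumerate m) (weight q) _ (enumerate-complete m _ u (u-alt , refl)))

enumerate-length-suc : ∀ m k → length (enumerate (suc m) k) ≡ mulLin (2 + m) (length ∘ enumerate m) k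
enumerate-length-suc m zero = trans (blocks-length (enumerate m) zero) (zero-count m (length (enumerate m zero)))
  where
  zero-count : ∀ m a → 0 + (0 + (a + m * 0)) ≡ a
  zero-count = solve-∀
enumerate-length-suc m (suc k) = trans (blocks-length (enumerate m) (suc k))
  (count m (length (enumerate m (suc k))) (length (enumerate m k)))
  where
  count : ∀ m a b → b + (b + (a + m * b)) ≡ a + (2 + m) * b
  count = solve-∀

mulLin-cong : ∀ t {p q : Poly} → (∀ k → p k ≡ q k) → ∀ k → mulLin t p k ≡ mulLin t q k
mulLin-cong t p≗q zero = p≗q zero
mulLin-cong t p≗q (suc k) = cong₂ (λ x y → x + t * y) (p≗q (suc k)) (p≗q k)

mulLin-comm : ∀ s t (p : Poly) k → mulLin s (mulLin t p) k ≡ mulLin t (mulLin s p) k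
mulLin-comm s t p zero = refl
mulLin-comm s t p (suc zero) = comm₁ s t (p 1) (p 0)
  where
  comm₁ : ∀ s t x y → (x + t * y) + s * y ≡ (x + s * y) + t * y
  comm₁ = solve-∀
mulLin-comm s t p (suc (suc k)) = comm₂ s t (p (suc (suc k))) (p (suc k)) (p k)
  where
  comm₂ : ∀ s t x y z → (x + t * y) + s * (y + t * z) ≡ (x + s * y) + t * (y + s * z)
  comm₂ = solve-∀

prodLin-snoc : ∀ ts t k → prodLin (ts ++ t ∷ []) k ≡ mulLin t (prodLin ts) k
prodLin-snoc [] t k = refl
prodLin-snoc (s ∷ ts) t k = trans (mulLin-cong s (prodLin-snoc ts t) k) (mulLin-comm s t (prodLin ts) k)

rhsPoly-suc : ∀ m k → rhsPoly (suc m) k ≡ mulLin (2 + m) (rhsPoly m) k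
rhsPoly-suc m k = begin
  prodLin (map (2 +_) (upTo (suc m))) k
    ≡⟨ cong (λ l → prodLin (map (2 +_) l) k) (sym (upTo-∷ʳ m)) ⟩
  prodLin (map (2 +_) (upTo m ++ m ∷ [])) k
    ≡⟨ cong (λ l → prodLin l k) (map-++ (2 +_) (upTo m) (m ∷ [])) ⟩
  prodLin (map (2 +_) (upTo m) ++ 2 + m ∷ []) k
    ≡⟨ prodLin-snoc (map (2 +_) (upTo m)) (2 + m) k ⟩
  mulLin (2 + m) (rhsPoly m) k ∎
  where open ≡-Reasoning

enumerate-length : ∀ m k → length (enumerate m k) ≡ rhsPoly m k
enumerate-length zero zero = refl
enumerate-length zero (suc k) = refl
enumerate-length (suc m) k = begin
  length (enumerate (suc m) k)               ≡⟨ enumerate-length-suc m k ⟩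
  mulLin (2 + m) (length ∘ enumerate m) k    ≡⟨ mulLin-cong (2 + m) (enumerate-length m) k ⟩
  mulLin (2 + m) (rhsPoly m) k               ≡⟨ sym (rhsPoly-suc m k) ⟩
  rhsPoly (suc m) k                          ∎
  where open ≡-Reasoning

theorem7p2 : ∀ (m k : ℕ) → CountIs m k (rhsPoly m k)
theorem7p2 m k = enumerate m k , enumerate-unique m k , characterisation , enumerate-length m k
  where
  characterisation : ∀ v → (v ∈ enumerate m k) ⇔ (InAlt v × HasLength v k)
  characterisation v = mk⇔
    (λ v∈ → let alt , depth≡k = enumerate-sound m k v∈ in alt , depth⇒HasLength m v k alt depth≡k)
    (λ (alt , has-length) → enumerate-complete m k v (alt , HasLength⇒depth m v k alt has-length))
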